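{- Let $c\geq 3$ and let $G_1, G_2, \ldots, G_c$ be oriented graphs on a common set of $n$ vertices. If $e(G_i) > \frac{1}{3}n^2$ for every $i \in \{1,\ldots,c\}$, then there exists a rainbow transitive triangle.
   Context: A directed graph $G$ consists of a vertex set $V(G)$ and an edge set $E(G)$ of ordered pairs of distinct vertices (no loops, no multiple edges). An oriented graph is a directed graph with no pair of vertices $u,v$ such that both $(u,v)$ and $(v,u)$ are edges. $e(G)=|E(G)|$. The edges of $G_i$ are thought of as having color $i$. A rainbow transitive triangle is a triple of distinct vertices $u,v,w$ together with pairwise distinct colors $a,b,d$ such that $(u,v)\in E(G_a)$, $(v,w)\in E(G_b)$, $(u,w)\in E(G_d)$. -}

module Defs where

open import Data.Nat using (ℕ; _+_)
open import Data.Bool using (Bool; true; false; if_then_else_)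
open import Data.Fin using (Fin)
open import Data.List using (List; map; allFin)
open import Data.Nat.ListAction using (sum)
open import Data.Product using (_×_; ∃-syntax)
open import Relation.Binary.PropositionalEquality using (_≡_; _≢_)
open import Relation.Nullary using (¬_)

Digraph : ℕ → Set
Digraph n = Fin n → Fin n → Bool

Edge : ∀ {n} → Digraph n → Fin n → Fin n → Set
Edge G u v = G u v ≡ true

IsOriented : ∀ {n} → Digraph n → Set
IsOriented {n} G = (u v : Fin n) → ¬ (Edge G u v × Edge G v u)

indicator : Bool → ℕ
indicator b = if b then 1 else 0

edgeCount : ∀ {n} → Digraph n → ℕ
edgeCount {n} G =
  sum (map (λ u → sum (map (λ v → indicator (G u v)) (allFin n))) (allFin n))

RainbowTransitiveTriangle : ∀ {c n} → (Fin c → Digraph n) → Set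
RainbowTransitiveTriangle {c} {n} G =
  ∃[ u ] ∃[ v ] ∃[ w ] ∃[ a ] ∃[ b ] ∃[ d ]
    (u ≢ v × v ≢ w × u ≢ w × a ≢ b × b ≢ d × a ≢ d ×
     Edge (G a) u v × Edge (G b) v w × Edge (G d) u w)

module Submission where

-- Only three of the colours are needed.  Let h(u,v) be the number of them with an arc u → v and
-- m(u,v) = h(u,v) + h(v,u) ≤ 3 the number joining u and v; the sum of h over ordered pairs is
-- e(G₁) + e(G₂) + e(G₃) > n².  Conversely, this sum is at most n² in the absence of a rainbow
-- transitive triangle: peel off a set X of at most three vertices with internal sum at most |X|²
-- and with m-weight at most 2|X| towards every remaining vertex, so that the bound survives by
-- induction, as (k + l)² = k² + 2kl + l².  Greedily growing X can only fail at vertices x, y, z, w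
-- with m(x,y) = 3, m(x,z) + m(y,z) ≥ 5 and m(x,w) + m(y,w) + m(z,w) ≥ 7, and a case analysis of
-- the orientations shows that every such configuration contains a rainbow transitive triangle:
-- a triangle whose pairs are joined in enough colours is rainbow transitive unless its arcs run
-- (almost) cyclically, and the cyclic orientations forced on the triangles through w are
-- incompatible.

open import Defs
open import Data.Nat using (ℕ; zero; suc; _+_; _*_; _<_; _≤_; z≤n; s≤s; s≤s⁻¹; _<?_)
open import Data.Nat.Properties
  using ( ≤-refl; ≤-trans; ≤-antisym; <-irrefl; ≤⇒≯; ≮⇒≥; n≤1+n; m<n+m; m≤n⇒m<n∨m≡n
        ; +-comm; +-assoc; +-identityʳ; *-suc; +-mono-≤; +-monoˡ-≤; +-monoʳ-≤; +-cancelˡ-≤; *-cancelˡ-≤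
        ; +-commutativeSemigroup; module ≤-Reasoning )
open import Algebra.Properties.CommutativeSemigroup +-commutativeSemigroup
  using (x∙yz≈y∙xz; x∙yz≈z∙xy) renaming (interchange to +-interchange)
open import Data.Nat.ListAction using (sum)
open import Data.Nat.ListAction.Properties using (sum-↭; sum-++)
open import Data.Nat.Tactic.RingSolver using (solve-∀)
open import Data.Fin using (Fin; zero; suc; inject≤; _≟_)
open import Data.Fin.Properties using (inject≤-injective)
open import Data.Bool using (Bool; true; false; _∨_)
open import Data.List using (List; []; _∷_; _++_; [_]; length; map; allFin)
open import Data.List.Properties using (length-++; length-tabulate; map-cong; map-++)
open import Data.List.Relation.Unary.Any using (Any; here; there; any?)
open import Data.List.Relation.Unary.All as All using (All; []; _∷_)
open import Data.List.Relation.Unary.All.Properties using (¬Any⇒All¬)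
open import Data.List.Relation.Binary.Permutation.Propositional
  using (_↭_; ↭-refl; ↭-prep; ↭-swap; ↭-trans)
open import Data.List.Relation.Binary.Permutation.Propositional.Properties using (map⁺; ↭-length)
open import Data.Product using (∃; ∃₂; _×_; _,_; proj₁; proj₂)
open import Data.Sum as Sum using (_⊎_; inj₁; inj₂)
open import Data.Empty using (⊥-elim)
open import Function using (_∘_; id)
open import Relation.Nullary using (¬_; yes; no)
open import Relation.Binary.PropositionalEquality
  using (_≡_; _≢_; refl; sym; trans; cong; cong₂; subst; subst₂; ≢-sym; module ≡-Reasoning)

module _ {A : Set} where

  sum-map-+ : ∀ (f g : A → ℕ) xs →
              sum (map (λ x → f x + g x) xs) ≡ sum (map f xs) + sum (map g xs)
  sum-map-+ f g []       = refl
  sum-map-+ f g (x ∷ xs) = begin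
    f x + g x + sum (map (λ x → f x + g x) xs)     ≡⟨ cong (f x + g x +_) (sum-map-+ f g xs) ⟩
    f x + g x + (sum (map f xs) + sum (map g xs))  ≡⟨ +-interchange (f x) (g x) _ _ ⟩
    f x + sum (map f xs) + (g x + sum (map g xs))  ∎
    where open ≡-Reasoning

  sum-map-+₃ : ∀ (f g k : A → ℕ) xs →
               sum (map (λ x → f x + g x + k x) xs) ≡ sum (map f xs) + sum (map g xs) + sum (map k xs)
  sum-map-+₃ f g k xs = trans (sum-map-+ (λ x → f x + g x) k xs) (cong (_+ sum (map k xs)) (sum-map-+ f g xs))

  sum-map-zero : ∀ xs → sum (map (λ (_ : A) → 0) xs) ≡ 0
  sum-map-zero []       = refl
  sum-map-zero (_ ∷ xs) = sum-map-zero xs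

  sum-map-≤ : ∀ {f : A → ℕ} {k xs} → All (λ x → f x ≤ k) xs → sum (map f xs) ≤ k * length xs
  sum-map-≤                 []                        = z≤n
  sum-map-≤ {f} {k} {x ∷ xs} (fx≤k ∷ ≤k) =
    subst (f x + sum (map f xs) ≤_) (sym (*-suc k (length xs))) (+-mono-≤ fx≤k (sum-map-≤ ≤k))

  sum-map-↭ : ∀ (f : A → ℕ) {xs ys} → xs ↭ ys → sum (map f xs) ≡ sum (map f ys)
  sum-map-↭ f = sum-↭ ∘ map⁺ f

  Any⇒↭∷ : ∀ {P : A → Set} {xs} → Any P xs → ∃₂ λ x ys → P x × xs ↭ x ∷ ys
  Any⇒↭∷ (here px) = _ , _ , px , ↭-refl
  Any⇒↭∷ (there any) with x , ys , px , σ ← Any⇒↭∷ any =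
    x , _ ∷ ys , px , ↭-trans (↭-prep _ σ) (↭-swap _ _ ↭-refl)

  exceeds-or-bounded : ∀ (f : A → ℕ) k xs → Any (λ x → k < f x) xs ⊎ All (λ x → f x ≤ k) xs
  exceeds-or-bounded f k xs with any? (λ x → k <? f x) xs
  ... | yes some = inj₁ some
  ... | no none  = inj₂ (All.map ≮⇒≥ (¬Any⇒All¬ xs none))

module WeightedDensity {V : Set} (h : V → V → ℕ)
  (h-irrefl : ∀ u → h u u ≡ 0) (mult≤3 : ∀ u v → h u v + h v u ≤ 3) where

  mult : V → V → ℕ
  mult u v = h u v + h v u

  total : List V → ℕ
  total L = sum (map (λ u → sum (map (h u) L)) L)

  weight : List V → V → ℕ
  weight X v = sum (map (λ x → mult x v) X)

  HeavyTo : List V → V → Set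
  HeavyTo X v = 2 * length X < weight X v

  data HeavyQuadruple : Set where
    heavyQuadruple : ∀ {x y z w} → HeavyTo [ x ] y → HeavyTo (x ∷ y ∷ []) z →
                     HeavyTo (x ∷ y ∷ z ∷ []) w → HeavyQuadruple

  heavyTo-↭ : ∀ {X Y v} → X ↭ Y → HeavyTo X v → HeavyTo Y v
  heavyTo-↭ {v = v} σ = subst₂ (λ k t → 2 * k < t) (↭-length σ) (sum-map-↭ (λ x → mult x v) σ)

  total-↭ : ∀ {L M} → L ↭ M → total L ≡ total M
  total-↭ {L} {M} σ = begin
    sum (map (λ u → sum (map (h u) L)) L)  ≡⟨ cong sum (map-cong (λ u → sum-map-↭ (h u) σ) L) ⟩
    sum (map (λ u → sum (map (h u) M)) L)  ≡⟨ sum-map-↭ _ σ ⟩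
    sum (map (λ u → sum (map (h u) M)) M)  ∎
    where open ≡-Reasoning

  total-∷ : ∀ x L → total (x ∷ L) ≡ sum (map (mult x) L) + total L
  total-∷ x L = begin
    (h x x + sum (map (h x) L)) + sum (map (λ u → h u x + sum (map (h u) L)) L)
      ≡⟨ cong₂ _+_ (cong (_+ sum (map (h x) L)) (h-irrefl x)) (sum-map-+ (λ u → h u x) _ L) ⟩
    sum (map (h x) L) + (sum (map (λ u → h u x) L) + total L)
      ≡⟨ sym (+-assoc (sum (map (h x) L)) (sum (map (λ u → h u x) L)) (total L)) ⟩
    sum (map (h x) L) + sum (map (λ u → h u x) L) + total L
      ≡⟨ cong (_+ total L) (sym (sum-map-+ (h x) (λ u → h u x) L)) ⟩
    sum (map (mult x) L) + total L  ∎
    where open ≡-Reasoning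

  total-++ : ∀ X L → total (X ++ L) ≡ total X + sum (map (weight X) L) + total L
  total-++ []      L = cong (_+ total L) (sym (sum-map-zero L))
  total-++ (x ∷ X) L = begin
    total (x ∷ X ++ L)
      ≡⟨ total-∷ x (X ++ L) ⟩
    sum (map (mult x) (X ++ L)) + total (X ++ L)
      ≡⟨ cong₂ _+_ (trans (cong sum (map-++ (mult x) X L)) (sum-++ (map (mult x) X) _)) (total-++ X L) ⟩
    (sum (map (mult x) X) + sum (map (mult x) L)) + (total X + sum (map (weight X) L) + total L)
      ≡⟨ regroup (sum (map (mult x) X)) _ (total X) _ _ ⟩
    (sum (map (mult x) X) + total X) + (sum (map (mult x) L) + sum (map (weight X) L)) + total L
      ≡⟨ sym (cong₂ (λ a b → a + b + total L) (total-∷ x X) (sum-map-+ (mult x) (weight X) L)) ⟩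
    total (x ∷ X) + sum (map (weight (x ∷ X)) L) + total L  ∎
    where
    open ≡-Reasoning
    regroup : ∀ a b c d e → (a + b) + (c + d + e) ≡ (a + c) + (b + d) + e
    regroup = solve-∀

  total-∷-≤ : ∀ x L → total (x ∷ L) ≤ 3 * length L + total L
  total-∷-≤ x L = subst (_≤ 3 * length L + total L) (sym (total-∷ x L))
    (+-monoˡ-≤ (total L) (sum-map-≤ {f = mult x} {xs = L} (All.tabulate (λ {v} _ → mult≤3 x v))))

  -- 3 * (k choose 2) ≤ k * k holds exactly for k ≤ 3, which is why peeling never removes four vertices.
  total-≤-square : ∀ X → length X ≤ 3 → total X ≤ length X * length X
  total-≤-square []                  _ = z≤n
  total-≤-square (x ∷ [])            _ = ≤-trans (total-∷-≤ x []) z≤n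
  total-≤-square (x ∷ y ∷ [])        _ =
    ≤-trans (total-∷-≤ x [ y ]) (≤-trans (+-monoʳ-≤ 3 (total-∷-≤ y [])) (n≤1+n 3))
  total-≤-square (x ∷ y ∷ z ∷ [])    _ =
    ≤-trans (total-∷-≤ x (y ∷ z ∷ [])) (+-monoʳ-≤ 6 (≤-trans (total-∷-≤ y [ z ]) (+-monoʳ-≤ 3 (total-∷-≤ z []))))
  total-≤-square (_ ∷ _ ∷ _ ∷ _ ∷ _) (s≤s (s≤s (s≤s ())))

  total-++-≤ : ∀ X L → total X ≤ length X * length X →
               All (λ v → weight X v ≤ 2 * length X) L → total L ≤ length L * length L →
               total (X ++ L) ≤ length (X ++ L) * length (X ++ L)
  total-++-≤ X L X≤ light L≤ = begin
    total (X ++ L)                              ≡⟨ total-++ X L ⟩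
    total X + sum (map (weight X) L) + total L  ≤⟨ +-mono-≤ (+-mono-≤ X≤ (sum-map-≤ light)) L≤ ⟩
    k * k + 2 * k * m + m * m                   ≡⟨ square-of-sum k m ⟩
    (k + m) * (k + m)                           ≡⟨ cong (λ n → n * n) (length-++ X) ⟨
    length (X ++ L) * length (X ++ L)           ∎
    where
    open ≤-Reasoning
    k = length X
    m = length L
    square-of-sum : ∀ k m → k * k + 2 * k * m + m * m ≡ (k + m) * (k + m)
    square-of-sum = solve-∀

  data Peeling (L : List V) : Set where
    peeling : ∀ X {L′} → L ↭ X ++ L′ → 0 < length X → length X ≤ 3 →
              All (λ v → weight X v ≤ 2 * length X) L′ → Peeling L

  heavyQuadruple⊎peeling : ∀ x L → HeavyQuadruple ⊎ Peeling (x ∷ L)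
  heavyQuadruple⊎peeling x L with exceeds-or-bounded (weight [ x ]) 2 L
  ... | inj₂ light = inj₂ (peeling [ x ] ↭-refl (s≤s z≤n) (s≤s z≤n) light)
  ... | inj₁ heavy₁ with Any⇒↭∷ heavy₁
  ... | y , L₁ , y-heavy , σ₁ with exceeds-or-bounded (weight (x ∷ y ∷ [])) 4 L₁
  ... | inj₂ light = inj₂ (peeling (x ∷ y ∷ []) (↭-prep x σ₁) (s≤s z≤n) (s≤s (s≤s z≤n)) light)
  ... | inj₁ heavy₂ with Any⇒↭∷ heavy₂
  ... | z , L₂ , z-heavy , σ₂ with exceeds-or-bounded (weight (x ∷ y ∷ z ∷ [])) 6 L₂
  ... | inj₂ light =
    inj₂ (peeling (x ∷ y ∷ z ∷ []) (↭-prep x (↭-trans σ₁ (↭-prep y σ₂))) (s≤s z≤n) ≤-refl light)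
  ... | inj₁ heavy₃ with Any⇒↭∷ heavy₃
  ... | w , _ , w-heavy , _ = inj₁ (heavyQuadruple y-heavy z-heavy w-heavy)

  density : ∀ L → HeavyQuadruple ⊎ total L ≤ length L * length L
  density L = bounded-by (length L) L ≤-refl
    where
    bounded-by : ∀ n L → length L ≤ n → HeavyQuadruple ⊎ total L ≤ length L * length L
    bounded-by _       []      _           = inj₂ z≤n
    bounded-by (suc n) (x ∷ L) (s≤s |L|≤n) with heavyQuadruple⊎peeling x L
    ... | inj₁ quadruple = inj₁ quadruple
    ... | inj₂ (peeling X {L′} σ nonempty |X|≤3 light) = Sum.map₂ peel (bounded-by n L′ shorter)
      where
      shorter : length L′ ≤ n
      shorter = s≤s⁻¹ (begin-strict
        length L′             <⟨ m<n+m (length L′) nonempty ⟩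
        length X + length L′  ≡⟨ length-++ X ⟨
        length (X ++ L′)      ≡⟨ ↭-length σ ⟨
        suc (length L)        ≤⟨ s≤s |L|≤n ⟩
        suc n                 ∎)
        where open ≤-Reasoning
      peel : total L′ ≤ length L′ * length L′ → total (x ∷ L) ≤ suc (length L) * suc (length L)
      peel L′≤ = subst₂ (λ t l → t ≤ l * l) (sym (total-↭ σ)) (sym (↭-length σ))
        (total-++-≤ X L′ (total-≤-square X |X|≤3) light L′≤)

≤3⇒≡3⊎≤2 : ∀ {a} → a ≤ 3 → a ≡ 3 ⊎ a ≤ 2
≤3⇒≡3⊎≤2 a≤3 with m≤n⇒m<n∨m≡n a≤3
... | inj₁ a<3 = inj₂ (s≤s⁻¹ a<3)
... | inj₂ a≡3 = inj₁ a≡3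

m+n≤o+p∧o≤m⇒n≤p : ∀ m {n o p} → m + n ≤ o + p → o ≤ m → n ≤ p
m+n≤o+p∧o≤m⇒n≤p m {n} {o} {p} m+n≤o+p o≤m = +-cancelˡ-≤ m n p (≤-trans m+n≤o+p (+-monoˡ-≤ p o≤m))

split₅ : ∀ {a b} → a ≤ 3 → b ≤ 3 → 5 ≤ a + b → (a ≡ 3 × 2 ≤ b) ⊎ (b ≡ 3 × 2 ≤ a)
split₅ {a} {b} a≤3 b≤3 5≤a+b with ≤3⇒≡3⊎≤2 a≤3
... | inj₁ refl = inj₁ (refl , m+n≤o+p∧o≤m⇒n≤p 3 5≤a+b ≤-refl)
... | inj₂ a≤2  = inj₂ (≤-antisym b≤3 (m+n≤o+p∧o≤m⇒n≤p 2 5≤a+b a≤2) ,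
                       m+n≤o+p∧o≤m⇒n≤p 3 (subst (5 ≤_) (+-comm a b) 5≤a+b) b≤3)

data Profile₇ (a b c : ℕ) : Set where
  3-2-2 : a ≡ 3 → 2 ≤ b → 2 ≤ c → Profile₇ a b c
  2-3-2 : 2 ≤ a → b ≡ 3 → 2 ≤ c → Profile₇ a b c
  2-2-3 : 2 ≤ a → 2 ≤ b → c ≡ 3 → Profile₇ a b c
  1-3-3 : 1 ≤ a → b ≡ 3 → c ≡ 3 → Profile₇ a b c
  3-1-3 : a ≡ 3 → 1 ≤ b → c ≡ 3 → Profile₇ a b c
  3-3-1 : a ≡ 3 → b ≡ 3 → 1 ≤ c → Profile₇ a b c

both≥ : ∀ k {a b} → k + k ≤ a + b → a ≤ k → b ≤ k → k ≤ a × k ≤ b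
both≥ k {a} {b} k+k≤a+b a≤k b≤k =
  m+n≤o+p∧o≤m⇒n≤p k (subst (k + k ≤_) (+-comm a b) k+k≤a+b) b≤k , m+n≤o+p∧o≤m⇒n≤p k k+k≤a+b a≤k

profile₇ : ∀ {a b c} → a ≤ 3 → b ≤ 3 → c ≤ 3 → 7 ≤ a + (b + c) → Profile₇ a b c
profile₇ {a} {b} {c} a≤3 b≤3 c≤3 7≤ with ≤3⇒≡3⊎≤2 a≤3 | ≤3⇒≡3⊎≤2 b≤3 | ≤3⇒≡3⊎≤2 c≤3
... | inj₁ refl | inj₁ refl | _         = 3-3-1 refl refl (+-cancelˡ-≤ 6 1 c 7≤)
... | inj₁ refl | inj₂ _    | inj₁ refl =
  3-1-3 refl (+-cancelˡ-≤ 6 1 b (subst (λ t → 7 ≤ 3 + t) (+-comm b 3) 7≤)) refl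
... | inj₁ refl | inj₂ b≤2  | inj₂ c≤2  =
  let 2≤b , 2≤c = both≥ 2 (+-cancelˡ-≤ 3 4 (b + c) 7≤) b≤2 c≤2 in 3-2-2 refl 2≤b 2≤c
... | inj₂ _    | inj₁ refl | inj₁ refl = 1-3-3 (+-cancelˡ-≤ 6 1 a (subst (7 ≤_) (+-comm a 6) 7≤)) refl refl
... | inj₂ a≤2  | inj₁ refl | inj₂ c≤2  =
  let 2≤a , 2≤c = both≥ 2 (+-cancelˡ-≤ 3 4 (a + c) (subst (7 ≤_) (x∙yz≈y∙xz a 3 c) 7≤)) a≤2 c≤2
  in 2-3-2 2≤a refl 2≤c
... | inj₂ a≤2  | inj₂ b≤2  | inj₁ refl =
  let 2≤a , 2≤b = both≥ 2 (+-cancelˡ-≤ 3 4 (a + b) (subst (7 ≤_) (x∙yz≈z∙xy a b 3) 7≤)) a≤2 b≤2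
  in 2-2-3 2≤a 2≤b refl
... | inj₂ a≤2  | inj₂ b≤2  | inj₂ c≤2  = ⊥-elim (≤⇒≯ (+-mono-≤ a≤2 (+-mono-≤ b≤2 c≤2)) 7≤)

<-sum-of-thirds : ∀ {a x y z} → a < 3 * x → a < 3 * y → a < 3 * z → a < x + y + z
<-sum-of-thirds {a} {x} {y} {z} a<3x a<3y a<3z = *-cancelˡ-≤ 3 (begin
  3 * suc a                  ≡⟨ triple (suc a) ⟩
  suc a + suc a + suc a      ≤⟨ +-mono-≤ (+-mono-≤ a<3x a<3y) a<3z ⟩
  3 * x + 3 * y + 3 * z      ≡⟨ distrib x y z ⟩
  3 * (x + y + z)            ∎)
  where
  open ≤-Reasoning
  triple : ∀ m → 3 * m ≡ m + m + m
  triple = solve-∀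
  distrib : ∀ x y z → 3 * x + 3 * y + 3 * z ≡ 3 * (x + y + z)
  distrib = solve-∀

indicator-∨ : ∀ {x y} → ¬ (x ≡ true × y ≡ true) → indicator x + indicator y ≡ indicator (x ∨ y)
indicator-∨ {true}  {true}  both = ⊥-elim (both (refl , refl))
indicator-∨ {true}  {false} _    = refl
indicator-∨ {false} {_}     _    = refl

∨≡true⇒⊎ : ∀ {x y} → x ∨ y ≡ true → x ≡ true ⊎ y ≡ true
∨≡true⇒⊎ {true}  _  = inj₁ refl
∨≡true⇒⊎ {false} xy = inj₂ xy

count : (Fin 3 → Bool) → ℕ
count f = indicator (f zero) + indicator (f (suc zero)) + indicator (f (suc (suc zero)))

count≤3 : ∀ f → count f ≤ 3
count≤3 f = +-mono-≤ (+-mono-≤ (indicator≤1 (f zero)) (indicator≤1 (f (suc zero)))) (indicator≤1 (f (suc (suc zero))))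
  where
  indicator≤1 : ∀ b → indicator b ≤ 1
  indicator≤1 true  = ≤-refl
  indicator≤1 false = z≤n

count≡3 : ∀ f → count f ≡ 3 → ∀ i → f i ≡ true
count≡3 f f≡3 with f zero in f₀ | f (suc zero) in f₁ | f (suc (suc zero)) in f₂ | f≡3
... | true  | true  | true  | _  = λ { zero → f₀ ; (suc zero) → f₁ ; (suc (suc zero)) → f₂ }
... | true  | true  | false | ()
... | true  | false | true  | ()
... | true  | false | false | ()
... | false | true  | true  | ()
... | false | true  | false | ()
... | false | false | true  | ()
... | false | false | false | ()

2≤count : ∀ f → 2 ≤ count f → ∃₂ λ a b → a ≢ b × f a ≡ true × f b ≡ true
2≤count f 2≤f with f zero in f₀ | f (suc zero) in f₁ | f (suc (suc zero)) in f₂ | 2≤f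
... | true  | true  | _     | _        = zero , suc zero , (λ ()) , f₀ , f₁
... | true  | false | true  | _        = zero , suc (suc zero) , (λ ()) , f₀ , f₂
... | false | true  | true  | _        = suc zero , suc (suc zero) , (λ ()) , f₁ , f₂
... | true  | false | false | s≤s ()
... | false | true  | false | s≤s ()
... | false | false | true  | s≤s ()
... | false | false | false | ()

1≤count : ∀ f → 1 ≤ count f → ∃ λ i → f i ≡ true
1≤count f 1≤f with f zero in f₀ | f (suc zero) in f₁ | f (suc (suc zero)) in f₂ | 1≤f
... | true  | _     | _     | _  = zero , f₀
... | false | true  | _     | _  = suc zero , f₁
... | false | false | true  | _  = suc (suc zero) , f₂
... | false | false | false | ()

record OtherColours (a : Fin 3) : Set where
  field
    b₁ b₂  : Fin 3
    b₁≢a   : b₁ ≢ a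
    b₂≢a   : b₂ ≢ a
    b₁≢b₂  : b₁ ≢ b₂
    ≢a⇒b₁⊎b₂ : ∀ i → i ≢ a → i ≡ b₁ ⊎ i ≡ b₂

others : ∀ a → OtherColours a
others zero = record
  { b₁ = suc zero ; b₂ = suc (suc zero) ; b₁≢a = λ () ; b₂≢a = λ () ; b₁≢b₂ = λ ()
  ; ≢a⇒b₁⊎b₂ = λ { zero i≢a → ⊥-elim (i≢a refl) ; (suc zero) _ → inj₁ refl ; (suc (suc zero)) _ → inj₂ refl } }
others (suc zero) = record
  { b₁ = zero ; b₂ = suc (suc zero) ; b₁≢a = λ () ; b₂≢a = λ () ; b₁≢b₂ = λ ()
  ; ≢a⇒b₁⊎b₂ = λ { zero _ → inj₁ refl ; (suc zero) i≢a → ⊥-elim (i≢a refl) ; (suc (suc zero)) _ → inj₂ refl } }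
others (suc (suc zero)) = record
  { b₁ = zero ; b₂ = suc zero ; b₁≢a = λ () ; b₂≢a = λ () ; b₁≢b₂ = λ ()
  ; ≢a⇒b₁⊎b₂ = λ { zero _ → inj₁ refl ; (suc zero) _ → inj₂ refl ; (suc (suc zero)) i≢a → ⊥-elim (i≢a refl) } }

third : ∀ {a b : Fin 3} → a ≢ b → ∃ λ d → d ≢ a × d ≢ b
third {a} {b} a≢b = pick (≢a⇒b₁⊎b₂ b (≢-sym a≢b))
  where
  open OtherColours (others a)
  pick : ∀ {c} → c ≡ b₁ ⊎ c ≡ b₂ → ∃ λ d → d ≢ a × d ≢ c
  pick (inj₁ refl) = b₂ , b₂≢a , ≢-sym b₁≢b₂
  pick (inj₂ refl) = b₁ , b₁≢a , b₁≢b₂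

merge-punctured : ∀ {n} {P : Fin n → Set} {a b} → a ≢ b →
                  (∀ i → i ≢ a → P i) → (∀ i → i ≢ b → P i) → ∀ i → P i
merge-punctured {a = a} a≢b off-a off-b i with i ≟ a
... | yes refl = off-b i a≢b
... | no i≢a   = off-a i i≢a

avoid : ∀ {n} {P : Fin n → Set} {a b} → a ≢ b → P a → P b → ∀ e → ∃ λ f → f ≢ e × P f
avoid {a = a} {b} a≢b pa pb e with a ≟ e
... | yes refl = b , ≢-sym a≢b , pb
... | no a≢e   = a , a≢e , pa

module ThreeOrientedGraphs {V : Set} (G : Fin 3 → V → V → Bool)
  (oriented : ∀ i u v → ¬ (G i u v ≡ true × G i v u ≡ true)) where

  Arc : Fin 3 → V → V → Set
  Arc i u v = G i u v ≡ true

  data RainbowTriangle : Set where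
    rainbow : ∀ {a b d u v w} → a ≢ b → b ≢ d → a ≢ d →
              Arc a u v → Arc b v w → Arc d u w → RainbowTriangle

  Adj : Fin 3 → V → V → Set
  Adj i u v = Arc i u v ⊎ Arc i v u

  Complete : V → V → Set
  Complete u v = ∀ i → Adj i u v

  Double : V → V → Set
  Double u v = ∃₂ λ a b → a ≢ b × Adj a u v × Adj b u v

  _⇉_ : V → V → Set
  u ⇉ v = ∀ i → Arc i u v

  NearCyclic : V → V → V → Set
  NearCyclic p q r = p ⇉ q × r ⇉ p × (∃₂ λ a b → a ≢ b × Arc a q r × Arc b q r)

  complete-sym : ∀ {u v} → Complete u v → Complete v u
  complete-sym uv i = Sum.swap (uv i)

  double-sym : ∀ {u v} → Double u v → Double v u
  double-sym (a , b , a≢b , uv-a , uv-b) = a , b , a≢b , Sum.swap uv-a , Sum.swap uv-b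

  complete⇒double : ∀ {u v} → Complete u v → Double u v
  complete⇒double uv = zero , suc zero , (λ ()) , uv zero , uv (suc zero)

  ⇉⇒complete : ∀ {u v} → u ⇉ v → Complete u v
  ⇉⇒complete uv i = inj₁ (uv i)

  arc-asym : ∀ {i u v} → Arc i u v → ¬ Arc i v u
  arc-asym uv vu = oriented _ _ _ (uv , vu)

  arc⇒≢ : ∀ {i u v} → Arc i u v → u ≢ v
  arc⇒≢ uv refl = arc-asym uv uv

  ⇉-asym : ∀ {u v} → u ⇉ v → ¬ v ⇉ u
  ⇉-asym uv vu = arc-asym (uv zero) (vu zero)

  punctured-⇉-asym : ∀ {e u v} → (∀ i → i ≢ e → Arc i u v) → ¬ v ⇉ u
  punctured-⇉-asym {e} uv vu = arc-asym (uv b₁ b₁≢a) (vu b₁)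
    where open OtherColours (others e)

  -- Every orientation of a triangle other than a directed cycle is transitive.
  rainbow⊎cyclic : ∀ {a b d p q r} → a ≢ b → b ≢ d → a ≢ d → Arc a q r → Adj b p q → Adj d p r →
                   RainbowTriangle ⊎ (Arc b p q × Arc d r p)
  rainbow⊎cyclic a≢b b≢d a≢d qr (inj₁ pq) (inj₁ pr) = inj₁ (rainbow (≢-sym a≢b) a≢d b≢d pq qr pr)
  rainbow⊎cyclic a≢b b≢d a≢d qr (inj₂ qp) (inj₁ pr) = inj₁ (rainbow b≢d (≢-sym a≢d) (≢-sym a≢b) qp pr qr)
  rainbow⊎cyclic a≢b b≢d a≢d qr (inj₂ qp) (inj₂ rp) = inj₁ (rainbow a≢d (≢-sym b≢d) a≢b qr rp qp)
  rainbow⊎cyclic a≢b b≢d a≢d qr (inj₁ pq) (inj₂ rp) = inj₂ (pq , rp)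

  rainbow⊎cyclic-off : ∀ {a p q r} → Complete p q → Complete p r → Arc a q r →
                       RainbowTriangle ⊎ (∀ i → i ≢ a → Arc i p q × Arc i r p)
  rainbow⊎cyclic-off {a} {p} {q} {r} pq pr qr =
    combine (rainbow⊎cyclic (≢-sym b₁≢a) b₁≢b₂ (≢-sym b₂≢a) qr (pq b₁) (pr b₂))
            (rainbow⊎cyclic (≢-sym b₂≢a) (≢-sym b₁≢b₂) (≢-sym b₁≢a) qr (pq b₂) (pr b₁))
    where
    open OtherColours (others a)
    combine : RainbowTriangle ⊎ (Arc b₁ p q × Arc b₂ r p) → RainbowTriangle ⊎ (Arc b₂ p q × Arc b₁ r p) →
              RainbowTriangle ⊎ (∀ i → i ≢ a → Arc i p q × Arc i r p)
    combine (inj₁ t)           _                  = inj₁ t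
    combine (inj₂ _)           (inj₁ t)           = inj₁ t
    combine (inj₂ (pq₁ , rp₂)) (inj₂ (pq₂ , rp₁)) = inj₂ λ i i≢a →
      Sum.[ (λ { refl → pq₁ , rp₁ }) , (λ { refl → pq₂ , rp₂ }) ] (≢a⇒b₁⊎b₂ i i≢a)

  rainbow⊎nearCyclic-at : ∀ {a b p q r} → a ≢ b → Complete p q → Complete p r → Arc a q r → Adj b q r →
                          RainbowTriangle ⊎ NearCyclic p q r
  rainbow⊎nearCyclic-at {a} {b} {p} {q} {r} a≢b pq pr qr-a qr-b =
    after-a (rainbow⊎cyclic-off pq pr qr-a) qr-b
    where
    after-a : RainbowTriangle ⊎ (∀ i → i ≢ a → Arc i p q × Arc i r p) → Adj b q r →
              RainbowTriangle ⊎ NearCyclic p q r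
    after-a (inj₁ t) _ = inj₁ t
    after-a (inj₂ off-a) (inj₁ qr-b) with rainbow⊎cyclic-off pq pr qr-b
    ... | inj₁ t     = inj₁ t
    ... | inj₂ off-b = inj₂ (proj₁ ∘ all , proj₂ ∘ all , a , b , a≢b , qr-a , qr-b)
      where
      all : ∀ i → Arc i p q × Arc i r p
      all = merge-punctured a≢b off-a off-b
    after-a (inj₂ off-a) (inj₂ rq-b) with rainbow⊎cyclic-off pr pq rq-b | third a≢b
    ... | inj₁ t     | _             = inj₁ t
    ... | inj₂ off-b | d , d≢a , d≢b = ⊥-elim (arc-asym (proj₁ (off-a d d≢a)) (proj₂ (off-b d d≢b)))

  rainbow⊎nearCyclic : ∀ {p q r} → Complete p q → Complete p r → Double q r →
                       RainbowTriangle ⊎ (NearCyclic p q r ⊎ NearCyclic p r q)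
  rainbow⊎nearCyclic pq pr (_ , _ , a≢b , inj₁ qr , qr-b) = Sum.map₂ inj₁ (rainbow⊎nearCyclic-at a≢b pq pr qr qr-b)
  rainbow⊎nearCyclic pq pr (_ , _ , a≢b , inj₂ rq , qr-b) =
    Sum.map₂ inj₂ (rainbow⊎nearCyclic-at a≢b pr pq rq (Sum.swap qr-b))

  ⇉-⇉-rainbow : ∀ {a u v t} → u ⇉ v → v ⇉ t → Arc a u t → RainbowTriangle
  ⇉-⇉-rainbow {a} uv vt ut = rainbow b₁≢b₂ b₂≢a b₁≢a (uv b₁) (vt b₂) ut
    where open OtherColours (others a)

  ⇉-double-rainbow : ∀ {a b e u v t} → a ≢ b → u ⇉ v → Arc a u t → Arc b u t → Adj e v t → RainbowTriangle
  ⇉-double-rainbow {e = e} a≢b uv ut-a ut-b vt-e with avoid a≢b ut-a ut-b e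
  ... | f , f≢e , ut-f with third (≢-sym f≢e)
  ... | m , m≢e , m≢f with vt-e
  ... | inj₁ vt = rainbow m≢e (≢-sym f≢e) m≢f (uv m) vt ut-f
  ... | inj₂ tv = rainbow f≢e (≢-sym m≢e) (≢-sym m≢f) ut-f tv (uv m)

  rainbow-given-q⇉p : ∀ {a p q r} → Complete p q → Complete p r → Arc a q r → q ⇉ p → RainbowTriangle
  rainbow-given-q⇉p pq pr qr q⇉p with rainbow⊎cyclic-off pq pr qr
  ... | inj₁ t   = t
  ... | inj₂ off = ⊥-elim (punctured-⇉-asym (λ i i≢a → proj₁ (off i i≢a)) q⇉p)

  rainbow-given-p⇉r : ∀ {a p q r} → Complete p q → Complete p r → Arc a q r → p ⇉ r → RainbowTriangle
  rainbow-given-p⇉r pq pr qr p⇉r with rainbow⊎cyclic-off pq pr qr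
  ... | inj₁ t   = t
  ... | inj₂ off = ⊥-elim (punctured-⇉-asym (λ i i≢a → proj₂ (off i i≢a)) p⇉r)

  rainbow⊎w⇉p : ∀ {p q r w} → NearCyclic p q r → Complete w p → Double w q → RainbowTriangle ⊎ w ⇉ p
  rainbow⊎w⇉p (p⇉q , _) wp wq with rainbow⊎nearCyclic (complete-sym wp) (⇉⇒complete p⇉q) wq
  ... | inj₁ t                      = inj₁ t
  ... | inj₂ (inj₁ (_ , q⇉p , _))   = ⊥-elim (⇉-asym p⇉q q⇉p)
  ... | inj₂ (inj₂ (_ , w⇉p , _))   = inj₂ w⇉p

  rainbow⊎p⇉w : ∀ {p q r w} → NearCyclic p q r → Complete w p → Double w r → RainbowTriangle ⊎ p ⇉ w
  rainbow⊎p⇉w (_ , r⇉p , _) wp wr with rainbow⊎nearCyclic (complete-sym wp) (complete-sym (⇉⇒complete r⇉p)) wr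
  ... | inj₁ t                      = inj₁ t
  ... | inj₂ (inj₁ (p⇉w , _))       = inj₂ p⇉w
  ... | inj₂ (inj₂ (p⇉r , _))       = ⊥-elim (⇉-asym r⇉p p⇉r)

  rainbow-3-2-2 : ∀ {p q r w} → NearCyclic p q r → Complete w p → Double w q → Double w r → RainbowTriangle
  rainbow-3-2-2 nc wp wq wr with rainbow⊎w⇉p nc wp wq | rainbow⊎p⇉w nc wp wr
  ... | inj₁ t   | _        = t
  ... | inj₂ _   | inj₁ t   = t
  ... | inj₂ w⇉p | inj₂ p⇉w = ⊥-elim (⇉-asym w⇉p p⇉w)

  rainbow-3-3-1 : ∀ {e p q r w} → NearCyclic p q r → Complete w p → Complete w q → Adj e w r → RainbowTriangle
  rainbow-3-3-1 nc@(_ , r⇉p , _) wp wq wr with rainbow⊎w⇉p nc wp (complete⇒double wq) | wr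
  ... | inj₁ t   | _        = t
  ... | inj₂ w⇉p | inj₁ wr = rainbow-given-q⇉p (complete-sym wp) (complete-sym (⇉⇒complete r⇉p)) wr w⇉p
  ... | inj₂ _   | inj₂ rw = rainbow-given-q⇉p (complete-sym (⇉⇒complete r⇉p)) (complete-sym wp) rw r⇉p

  rainbow-3-1-3 : ∀ {e p q r w} → NearCyclic p q r → Complete w p → Adj e w q → Complete w r → RainbowTriangle
  rainbow-3-1-3 nc@(p⇉q , _) wp wq wr with rainbow⊎p⇉w nc wp (complete⇒double wr) | wq
  ... | inj₁ t   | _        = t
  ... | inj₂ _   | inj₁ wq = rainbow-given-p⇉r (complete-sym wp) (⇉⇒complete p⇉q) wq p⇉q
  ... | inj₂ p⇉w | inj₂ qw = rainbow-given-p⇉r (⇉⇒complete p⇉q) (complete-sym wp) qw p⇉w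

  rainbow-1-3-3 : ∀ {e p q r w} → NearCyclic p q r → Adj e w p → Complete w q → Complete w r → RainbowTriangle
  rainbow-1-3-3 (p⇉q , r⇉p , a , b , a≢b , qr-a , qr-b) wp wq wr
    with rainbow⊎nearCyclic wq wr (a , b , a≢b , inj₁ qr-a , inj₁ qr-b) | wp
  ... | inj₁ t                      | _       = t
  ... | inj₂ (inj₁ (w⇉q , _))       | inj₁ wp = rainbow-given-q⇉p (complete-sym wq) (complete-sym (⇉⇒complete p⇉q)) wp w⇉q
  ... | inj₂ (inj₁ _)               | inj₂ pw = rainbow-given-q⇉p (complete-sym (⇉⇒complete p⇉q)) (complete-sym wq) pw p⇉q
  ... | inj₂ (inj₂ (w⇉r , _))       | inj₁ wp = ⇉-⇉-rainbow w⇉r r⇉p wp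
  ... | inj₂ (inj₂ (_ , q⇉w , _))   | inj₂ pw = ⇉-⇉-rainbow p⇉q q⇉w pw

  rainbow-2-3-2 : ∀ {p q r w} → NearCyclic p q r → Double w p → Complete w q → Double w r → RainbowTriangle
  rainbow-2-3-2 (p⇉q , _ , _ , _ , a≢b , qr-a , qr-b) wp wq (_ , _ , _ , wr-e , _)
    with rainbow⊎nearCyclic (complete-sym (⇉⇒complete p⇉q)) (complete-sym wq) (double-sym wp)
  ... | inj₁ t                      = t
  ... | inj₂ (inj₁ (q⇉p , _))       = ⊥-elim (⇉-asym p⇉q q⇉p)
  ... | inj₂ (inj₂ (q⇉w , _))       = ⇉-double-rainbow a≢b q⇉w qr-a qr-b wr-e

  rainbow-2-2-3 : ∀ {p q r w} → NearCyclic p q r → Double w p → Double w q → Complete w r → RainbowTriangle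
  rainbow-2-2-3 (p⇉q , r⇉p , _) (α , β , α≢β , wp-α , wp-β) (_ , _ , _ , wq-e , _) wr
    with rainbow⊎nearCyclic (⇉⇒complete r⇉p) (complete-sym wr) (α , β , α≢β , Sum.swap wp-α , Sum.swap wp-β)
       | wp-α | wp-β
  ... | inj₁ t                    | _         | _         = t
  ... | inj₂ (inj₂ (_ , p⇉r , _)) | _         | _         = ⊥-elim (⇉-asym r⇉p p⇉r)
  ... | inj₂ (inj₁ (_ , w⇉r , _)) | inj₁ wp   | _         = ⇉-⇉-rainbow w⇉r r⇉p wp
  ... | inj₂ (inj₁ (_ , w⇉r , _)) | inj₂ _    | inj₁ wp   = ⇉-⇉-rainbow w⇉r r⇉p wp
  ... | inj₂ (inj₁ _)             | inj₂ pw-α | inj₂ pw-β = ⇉-double-rainbow α≢β p⇉q pw-α pw-β (Sum.swap wq-e)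

  loopless : ∀ i u → G i u u ≡ false
  loopless i u with G i u u in uu
  ... | true  = ⊥-elim (oriented i u u (uu , uu))
  ... | false = refl

  arcs : V → V → ℕ
  arcs u v = count (λ i → G i u v)

  arcs-irrefl : ∀ u → arcs u u ≡ 0
  arcs-irrefl u rewrite loopless zero u | loopless (suc zero) u | loopless (suc (suc zero)) u = refl

  adjacent? : Fin 3 → V → V → Bool
  adjacent? i u v = G i u v ∨ G i v u

  adjacencies : V → V → ℕ
  adjacencies u v = count (λ i → adjacent? i u v)

  arcs+arcs≡adjacencies : ∀ u v → arcs u v + arcs v u ≡ adjacencies u v
  arcs+arcs≡adjacencies u v = begin
    (a₀ + a₁ + a₂) + (b₀ + b₁ + b₂)  ≡⟨ regroup a₀ a₁ a₂ b₀ b₁ b₂ ⟩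
    (a₀ + b₀) + (a₁ + b₁) + (a₂ + b₂)
      ≡⟨ cong₂ _+_ (cong₂ _+_ (indicator-∨ (oriented zero u v)) (indicator-∨ (oriented (suc zero) u v)))
                   (indicator-∨ (oriented (suc (suc zero)) u v)) ⟩
    adjacencies u v  ∎
    where
    open ≡-Reasoning
    a₀ = indicator (G zero u v)
    a₁ = indicator (G (suc zero) u v)
    a₂ = indicator (G (suc (suc zero)) u v)
    b₀ = indicator (G zero v u)
    b₁ = indicator (G (suc zero) v u)
    b₂ = indicator (G (suc (suc zero)) v u)
    regroup : ∀ a₀ a₁ a₂ b₀ b₁ b₂ → (a₀ + a₁ + a₂) + (b₀ + b₁ + b₂) ≡ (a₀ + b₀) + (a₁ + b₁) + (a₂ + b₂)
    regroup = solve-∀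

  arcs+arcs≤3 : ∀ u v → arcs u v + arcs v u ≤ 3
  arcs+arcs≤3 u v = subst (_≤ 3) (sym (arcs+arcs≡adjacencies u v)) (count≤3 (λ i → adjacent? i u v))

  open WeightedDensity arcs arcs-irrefl arcs+arcs≤3 public

  adjacent : ∀ {i u v} → adjacent? i u v ≡ true → Adj i u v
  adjacent = ∨≡true⇒⊎

  mult≡3⇒complete : ∀ {u v} → mult u v ≡ 3 → Complete u v
  mult≡3⇒complete {u} {v} uv≡3 i =
    adjacent (count≡3 (λ i → adjacent? i u v) (trans (sym (arcs+arcs≡adjacencies u v)) uv≡3) i)

  2≤mult⇒double : ∀ {u v} → 2 ≤ mult u v → Double u v
  2≤mult⇒double {u} {v} 2≤uv with 2≤count (λ i → adjacent? i u v) (subst (2 ≤_) (arcs+arcs≡adjacencies u v) 2≤uv)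
  ... | a , b , a≢b , uv-a , uv-b = a , b , a≢b , adjacent uv-a , adjacent uv-b

  1≤mult⇒adj : ∀ {u v} → 1 ≤ mult u v → ∃ λ e → Adj e u v
  1≤mult⇒adj {u} {v} 1≤uv with 1≤count (λ i → adjacent? i u v) (subst (1 ≤_) (arcs+arcs≡adjacencies u v) 1≤uv)
  ... | e , uv-e = e , adjacent uv-e

  nearCyclic⇒rainbow : ∀ {p q r w} → NearCyclic p q r → HeavyTo (p ∷ q ∷ r ∷ []) w → RainbowTriangle
  nearCyclic⇒rainbow {p} {q} {r} {w} nc w-heavy =
    by-profile (profile₇ (arcs+arcs≤3 p w) (arcs+arcs≤3 q w) (arcs+arcs≤3 r w)
                         (subst (λ t → 7 ≤ mult p w + (mult q w + t)) (+-identityʳ (mult r w)) w-heavy))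
    where
    complete← : ∀ {u} → mult u w ≡ 3 → Complete w u
    complete← = complete-sym ∘ mult≡3⇒complete
    double← : ∀ {u} → 2 ≤ mult u w → Double w u
    double← = double-sym ∘ 2≤mult⇒double
    adj← : ∀ {u} (uw : 1 ≤ mult u w) → Adj (proj₁ (1≤mult⇒adj uw)) w u
    adj← uw = Sum.swap (proj₂ (1≤mult⇒adj uw))
    by-profile : Profile₇ (mult p w) (mult q w) (mult r w) → RainbowTriangle
    by-profile (3-2-2 pw qw rw) = rainbow-3-2-2 nc (complete← pw) (double← qw) (double← rw)
    by-profile (2-3-2 pw qw rw) = rainbow-2-3-2 nc (double← pw) (complete← qw) (double← rw)
    by-profile (2-2-3 pw qw rw) = rainbow-2-2-3 nc (double← pw) (double← qw) (complete← rw)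
    by-profile (1-3-3 pw qw rw) = rainbow-1-3-3 nc (adj← pw) (complete← qw) (complete← rw)
    by-profile (3-1-3 pw qw rw) = rainbow-3-1-3 nc (complete← pw) (adj← qw) (complete← rw)
    by-profile (3-3-1 pw qw rw) = rainbow-3-3-1 nc (complete← pw) (complete← qw) (adj← rw)

  heavyQuadruple⇒rainbow : HeavyQuadruple → RainbowTriangle
  heavyQuadruple⇒rainbow (heavyQuadruple {x} {y} {z} {w} y-heavy z-heavy w-heavy) =
    by-split (split₅ (arcs+arcs≤3 x z) (arcs+arcs≤3 y z)
                     (subst (λ t → 5 ≤ mult x z + t) (+-identityʳ (mult y z)) z-heavy))
    where
    xy : Complete x y
    xy = mult≡3⇒complete (≤-antisym (arcs+arcs≤3 x y) (subst (3 ≤_) (+-identityʳ (mult x y)) y-heavy))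
    close : ∀ {p q r} → RainbowTriangle ⊎ (NearCyclic p q r ⊎ NearCyclic p r q) →
            x ∷ y ∷ z ∷ [] ↭ p ∷ q ∷ r ∷ [] → RainbowTriangle
    close (inj₁ t)          _ = t
    close (inj₂ (inj₁ nc)) σ = nearCyclic⇒rainbow nc (heavyTo-↭ σ w-heavy)
    close (inj₂ (inj₂ nc)) σ = nearCyclic⇒rainbow nc (heavyTo-↭ (↭-trans σ (↭-prep _ (↭-swap _ _ ↭-refl))) w-heavy)
    by-split : (mult x z ≡ 3 × 2 ≤ mult y z) ⊎ (mult y z ≡ 3 × 2 ≤ mult x z) → RainbowTriangle
    by-split (inj₁ (xz , yz)) =
      close (rainbow⊎nearCyclic xy (mult≡3⇒complete xz) (2≤mult⇒double yz)) ↭-refl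
    by-split (inj₂ (yz , xz)) =
      close (rainbow⊎nearCyclic (complete-sym xy) (mult≡3⇒complete yz) (2≤mult⇒double xz)) (↭-swap x y ↭-refl)

  rainbow⊎total≤square : ∀ L → RainbowTriangle ⊎ total L ≤ length L * length L
  rainbow⊎total≤square L = Sum.map₁ heavyQuadruple⇒rainbow (density L)

  arcCount : Fin 3 → List V → ℕ
  arcCount i L = sum (map (λ u → sum (map (λ v → indicator (G i u v)) L)) L)

  total≡arcCounts : ∀ L → total L ≡ arcCount zero L + arcCount (suc zero) L + arcCount (suc (suc zero)) L
  total≡arcCounts L = begin
    sum (map (λ u → sum (map (arcs u) L)) L)
      ≡⟨ cong sum (map-cong (λ u → sum-map-+₃ (arc zero u) (arc (suc zero) u) (arc (suc (suc zero)) u) L) L) ⟩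
    sum (map (λ u → row zero u + row (suc zero) u + row (suc (suc zero)) u) L)
      ≡⟨ sum-map-+₃ (row zero) (row (suc zero)) (row (suc (suc zero))) L ⟩
    arcCount zero L + arcCount (suc zero) L + arcCount (suc (suc zero)) L  ∎
    where
    open ≡-Reasoning
    arc : Fin 3 → V → V → ℕ
    arc i u v = indicator (G i u v)
    row : Fin 3 → V → ℕ
    row i u = sum (map (arc i u) L)

module FirstThreeColours {c n} (3≤c : 3 ≤ c) (G : Fin c → Digraph n)
  (oriented : (i : Fin c) → IsOriented (G i)) where

  restrict : Fin 3 → Fin c
  restrict i = inject≤ i 3≤c

  open ThreeOrientedGraphs (G ∘ restrict) (oriented ∘ restrict) public

  rainbowTransitiveTriangle : RainbowTriangle → RainbowTransitiveTriangle G
  rainbowTransitiveTriangle (rainbow {a} {b} {d} {u} {v} {w} a≢b b≢d a≢d uv vw uw) =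
    u , v , w , restrict a , restrict b , restrict d ,
    arc⇒≢ uv , arc⇒≢ vw , arc⇒≢ uw , restrict-≢ a≢b , restrict-≢ b≢d , restrict-≢ a≢d , uv , vw , uw
    where
    restrict-≢ : ∀ {i j} → i ≢ j → restrict i ≢ restrict j
    restrict-≢ {i} {j} i≢j = i≢j ∘ inject≤-injective 3≤c 3≤c i j

theorem4 : (c n : ℕ) → 3 ≤ c → (G : Fin c → Digraph n) →
    ((i : Fin c) → IsOriented (G i)) →
    ((i : Fin c) → n * n < 3 * edgeCount (G i)) →
    RainbowTransitiveTriangle G
theorem4 c n 3≤c G oriented dense =
  Sum.[ rainbowTransitiveTriangle , ⊥-elim ∘ too-sparse ] (rainbow⊎total≤square (allFin n))
  where
  open FirstThreeColours 3≤c G oriented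
  e : Fin 3 → ℕ
  e i = edgeCount (G (restrict i))
  too-sparse : ¬ total (allFin n) ≤ length (allFin n) * length (allFin n)
  too-sparse total≤ = <-irrefl refl (begin-strict
    n * n                                  <⟨ <-sum-of-thirds {x = e zero} {e (suc zero)} {e (suc (suc zero))}
                                                (dense (restrict zero)) (dense (restrict (suc zero)))
                                                (dense (restrict (suc (suc zero)))) ⟩
    e zero + e (suc zero) + e (suc (suc zero))  ≡⟨ total≡arcCounts (allFin n) ⟨
    total (allFin n)                       ≤⟨ total≤ ⟩
    length (allFin n) * length (allFin n)  ≡⟨ cong (λ l → l * l) (length-tabulate {n = n} id) ⟩
    n * n                                  ∎)
    where open ≤-Reasoning
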